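{- The STT algorithm uses $O(n)$ memory in the RAM model for any connected $n$-vertex graph $G$ given as input to the algorithm.
   Context: The STT algorithm is run with respect to a function $f:\mathbb{N}\to\mathbb{N}$ and a separation algorithm $\mathcal{S}$ which, given a graph $H$, returns a partition $(A,B,C)$ of $V(H)$ with no edge between $A$ and $B$, $|A|,|B|\le\frac23|V(H)|$ and $|C|\le f(|V(H)|)$. STT on an $n$-vertex graph $G$ (a cop strategy in zero-visibility Cops and Robbers): it keeps Stack-B of pairs (vertex set, binary string index) and Stack-C of pairs (separator, index). Scheduler: push $(V(G),\varepsilon)$ ($\varepsilon$ the empty string) on Stack-B, Stack-C empty. While Stack-B is nonempty: pop $(U,w)$; let $p$ be $w$ without its last character; if Stack-C is nonempty then, while $p$ differs from the index of the top of Stack-C, pop $(S,w')$ from Stack-C and remove the cops from $S$; then call Separate$(G[U],w,n)$. Separate$(H,w,n)$: if $|V(H)|\le f(n)$, place cops on all vertices of $H$ and then remove them; otherwise compute $(A,B,C)=\mathcal{S}(H)$, place cops on all vertices of $C$, push $(C,w)$ onto Stack-C, then push $(B,w\cdot0)$ and $(A,w\cdot1)$ onto Stack-B. Memory is measured by the vertex sets stored in the two stacks. -}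

module Defs where

open import Data.Nat using (ℕ; zero; suc; _+_; _*_; _≤_; _≤?_)
open import Data.Fin using (Fin)
open import Data.Fin.Subset using (Subset; _∈_; ∣_∣)
open import Data.Bool using (Bool; true; false)
open import Data.Bool.Properties using () renaming (_≟_ to _≟B_)
open import Data.List using (List; []; _∷_; _++_)
open import Data.List.Properties using (≡-dec)
open import Data.Product using (_×_; _,_)
open import Data.Sum using (_⊎_)
open import Data.Empty using (⊥)
open import Relation.Nullary using (does)
open import Relation.Binary.PropositionalEquality using (_≡_)

record Graph (n : ℕ) : Set where
  field
    adj    : Fin n → Fin n → Bool
    sym    : ∀ u v → adj u v ≡ adj v u
    irrefl : ∀ v → adj v v ≡ false
open Graph public

data Reach {n : ℕ} (G : Graph n) (u : Fin n) : Fin n → Set where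
  here : Reach G u u
  step : ∀ {v w} → Reach G u v → adj G v w ≡ true → Reach G u w

Connected : {n : ℕ} → Graph n → Set
Connected G = ∀ u v → Reach G u v

Triple : ℕ → Set
Triple n = Subset n × Subset n × Subset n

ValidSeparation : (f : ℕ → ℕ) {n : ℕ} → Graph n → Subset n → Triple n → Set
ValidSeparation f G U (A , B , C) =
  (∀ x → x ∈ U → (x ∈ A ⊎ x ∈ B ⊎ x ∈ C)) ×
  (∀ x → x ∈ A → x ∈ U) × (∀ x → x ∈ B → x ∈ U) × (∀ x → x ∈ C → x ∈ U) ×
  (∀ x → x ∈ A → x ∈ B → ⊥) × (∀ x → x ∈ A → x ∈ C → ⊥) × (∀ x → x ∈ B → x ∈ C → ⊥) ×
  (∀ a b → a ∈ A → b ∈ B → adj G a b ≡ false) ×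
  (3 * ∣ A ∣ ≤ 2 * ∣ U ∣) × (3 * ∣ B ∣ ≤ 2 * ∣ U ∣) × (∣ C ∣ ≤ f ∣ U ∣)

-- A separation algorithm: given a graph H = G[U] (presented as a host graph
-- G and a vertex set U), returns (A , B , C).
SepAlg : Set
SepAlg = ∀ {n} → Graph n → Subset n → Triple n

IsSeparationAlgorithm : (ℕ → ℕ) → SepAlg → Set
IsSeparationAlgorithm f 𝒮 = ∀ {n} (G : Graph n) (U : Subset n) → ValidSeparation f G U (𝒮 G U)

BinStr : Set
BinStr = List Bool

dropLast : BinStr → BinStr
dropLast []           = []
dropLast (x ∷ [])     = []
dropLast (x ∷ y ∷ xs) = x ∷ dropLast (y ∷ xs)

_==_ : BinStr → BinStr → Bool
w == w' = does (≡-dec _≟B_ w w')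

-- Stacks: head of the list = top of the stack.
Stack : ℕ → Set
Stack n = List (Subset n × BinStr)

record State (n : ℕ) : Set where
  constructor ⟨_,_⟩
  field
    stackB : Stack n
    stackC : Stack n
open State public

initState : {n : ℕ} → Subset n → State n
initState V = ⟨ (V , []) ∷ [] , [] ⟩

-- while p differs from the index of the top of Stack-C, pop Stack-C
-- (removing the cops from the popped separator has no effect on memory)
popUntil : {n : ℕ} → BinStr → Stack n → Stack n
popUntil p []               = []
popUntil p ((S , w') ∷ st) with p == w'
... | true  = (S , w') ∷ st
... | false = popUntil p st

-- One iteration of the scheduler's while loop (identity when Stack-B is empty).
-- Cop placements/removals are not recorded, as they do not affect the stacks.
sttStep : (f : ℕ → ℕ) (𝒮 : SepAlg) {n : ℕ} → Graph n → State n → State n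
sttStep f 𝒮 {n} G ⟨ [] , sc ⟩ = ⟨ [] , sc ⟩
sttStep f 𝒮 {n} G ⟨ (U , w) ∷ sb , sc ⟩ = separate (does (∣ U ∣ ≤? f n)) (𝒮 G U)
  where
  sc' : Stack _
  sc' = popUntil (dropLast w) sc
  separate : Bool → Triple _ → State _
  separate true  _           = ⟨ sb , sc' ⟩
  separate false (A , B , C) = ⟨ (A , w ++ (true ∷ [])) ∷ (B , w ++ (false ∷ [])) ∷ sb
                               , (C , w) ∷ sc' ⟩

sttRun : (f : ℕ → ℕ) (𝒮 : SepAlg) {n : ℕ} → Graph n → ℕ → State n
sttRun f 𝒮 {n} G zero    = initState (Data.Fin.Subset.⊤)
sttRun f 𝒮 {n} G (suc k) = sttStep f 𝒮 G (sttRun f 𝒮 G k)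

stackSize : {n : ℕ} → Stack n → ℕ
stackSize []            = 0
stackSize ((S , _) ∷ st) = ∣ S ∣ + stackSize st

memory : {n : ℕ} → State n → ℕ
memory s = stackSize (stackB s) + stackSize (stackC s)

-- Every vertex lies in at most one of the sets stored on the two stacks:
-- initially only V(G) is stored, and a step replaces a set U by the three
-- pairwise disjoint parts A, B, C ⊆ U (or by nothing), while popping Stack-C
-- only removes sets. Counting vertex memberships, the stored sets therefore
-- have total size at most n, for every graph and every time step.
module Submission where

open import Defs hiding (sym)
open import Data.Nat using (ℕ; zero; suc; _+_; _*_; _≤_; _≤?_; z≤n)
open import Data.Nat.Properties
  using (≤-refl; ≤-trans; +-assoc; +-mono-≤; +-monoʳ-≤; +-monoˡ-≤; m≤n+m; *-identityˡ; *-identityʳ;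
         module ≤-Reasoning)
open import Data.Nat.Solver using (module +-*-Solver)
open import Data.Bool using (Bool; true; false)
open import Data.Fin as Fin using (Fin)
open import Data.Fin.Subset using (Subset; ∣_∣)
open import Data.Vec using ([]; _∷_; lookup; tail)
open import Data.Vec.Properties using (lookup⇒[]=; []=⇒lookup; lookup-replicate)
open import Data.List using ([]; _∷_; _++_; map)
open import Data.Product using (∃; _,_; map₁)
open import Data.Empty using (⊥; ⊥-elim)
open import Relation.Nullary using (does)
open import Relation.Binary.PropositionalEquality using (_≡_; refl; sym; cong; subst)

indicator : Bool → ℕ
indicator true  = 1
indicator false = 0

indicator≤1 : ∀ x → indicator x ≤ 1
indicator≤1 true  = ≤-refl
indicator≤1 false = z≤n

indicator-absent : ∀ x → (x ≡ true → false ≡ true) → indicator x ≡ 0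
indicator-absent false _ = refl
indicator-absent true  h with h refl
... | ()

indicator-atMostOne : ∀ x y z →
  (x ≡ true → y ≡ true → ⊥) → (x ≡ true → z ≡ true → ⊥) → (y ≡ true → z ≡ true → ⊥) →
  indicator x + (indicator y + indicator z) ≤ 1
indicator-atMostOne true  true  _     xy _  _  = ⊥-elim (xy refl refl)
indicator-atMostOne true  false true  _  xz _  = ⊥-elim (xz refl refl)
indicator-atMostOne true  false false _  _  _  = ≤-refl
indicator-atMostOne false true  true  _  _  yz = ⊥-elim (yz refl refl)
indicator-atMostOne false true  false _  _  _  = ≤-refl
indicator-atMostOne false false z     _  _  _  = indicator≤1 z

indicator-disjointParts : ∀ x y z u →
  (x ≡ true → u ≡ true) → (y ≡ true → u ≡ true) → (z ≡ true → u ≡ true) →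
  (x ≡ true → y ≡ true → ⊥) → (x ≡ true → z ≡ true → ⊥) → (y ≡ true → z ≡ true → ⊥) →
  indicator x + (indicator y + indicator z) ≤ indicator u
indicator-disjointParts x y z true  _  _  _  xy xz yz = indicator-atMostOne x y z xy xz yz
indicator-disjointParts x y z false xu yu zu _  _  _
  rewrite indicator-absent x xu | indicator-absent y yu | indicator-absent z zu = z≤n

∣x∷p∣≡ : ∀ {n} x (p : Subset n) → ∣ x ∷ p ∣ ≡ indicator x + ∣ p ∣
∣x∷p∣≡ true  p = refl
∣x∷p∣≡ false p = refl

occurrences : ∀ {n} → Fin n → Stack n → ℕ
occurrences i []             = 0
occurrences i ((S , _) ∷ st) = indicator (lookup S i) + occurrences i st

occurrences-++ : ∀ {n} i (st st′ : Stack n) →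
  occurrences i (st ++ st′) ≡ occurrences i st + occurrences i st′
occurrences-++ i []             st′ = refl
occurrences-++ i ((S , _) ∷ st) st′ rewrite occurrences-++ i st st′ =
  sym (+-assoc (indicator (lookup S i)) (occurrences i st) (occurrences i st′))

stackSize-++ : ∀ {n} (st st′ : Stack n) → stackSize (st ++ st′) ≡ stackSize st + stackSize st′
stackSize-++ []             st′ = refl
stackSize-++ ((S , _) ∷ st) st′ rewrite stackSize-++ st st′ =
  sym (+-assoc ∣ S ∣ (stackSize st) (stackSize st′))

occurrences-popUntil : ∀ {n} i p (st : Stack n) → occurrences i (popUntil p st) ≤ occurrences i st
occurrences-popUntil i p []              = z≤n
occurrences-popUntil i p ((S , w′) ∷ st) with p == w′
... | true  = ≤-refl
... | false = ≤-trans (occurrences-popUntil i p st) (m≤n+m _ _)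

dropFirstVertex : ∀ {n} → Stack (suc n) → Stack n
dropFirstVertex = map (map₁ tail)

stackSize-dropFirstVertex : ∀ {n} (st : Stack (suc n)) →
  stackSize st ≡ occurrences Fin.zero st + stackSize (dropFirstVertex st)
stackSize-dropFirstVertex []                   = refl
stackSize-dropFirstVertex ((x ∷ p , _) ∷ st)
  rewrite ∣x∷p∣≡ x p | stackSize-dropFirstVertex st =
  solve 4 (λ a b c d → (a :+ b) :+ (c :+ d) := (a :+ c) :+ (b :+ d))
    refl (indicator x) ∣ p ∣ (occurrences Fin.zero st) (stackSize (dropFirstVertex st))
  where open +-*-Solver

occurrences-dropFirstVertex : ∀ {n} i (st : Stack (suc n)) →
  occurrences (Fin.suc i) st ≡ occurrences i (dropFirstVertex st)
occurrences-dropFirstVertex i []                 = refl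
occurrences-dropFirstVertex i ((_ ∷ p , _) ∷ st) =
  cong (indicator (lookup p i) +_) (occurrences-dropFirstVertex i st)

stackSize≤n*m : ∀ {n m} (st : Stack n) → (∀ i → occurrences i st ≤ m) → stackSize st ≤ n * m
stackSize≤n*m {zero}      []              _ = z≤n
stackSize≤n*m {zero}  {m} (([] , _) ∷ st) _ = stackSize≤n*m {m = m} st (λ ())
stackSize≤n*m {suc n}     st              h rewrite stackSize-dropFirstVertex st =
  +-mono-≤ (h Fin.zero)
           (stackSize≤n*m (dropFirstVertex st)
                          (λ i → subst (_≤ _) (occurrences-dropFirstVertex i st) (h (Fin.suc i))))

stateOccurrences : ∀ {n} → Fin n → State n → ℕ
stateOccurrences i s = occurrences i (stackB s) + occurrences i (stackC s)

validSeparation-indicator : ∀ f {n} (G : Graph n) {U A B C : Subset n} →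
  ValidSeparation f G U (A , B , C) → ∀ i →
  indicator (lookup A i) + (indicator (lookup B i) + indicator (lookup C i)) ≤ indicator (lookup U i)
validSeparation-indicator _ _ {A = A} {B} {C} (_ , A⊆U , B⊆U , C⊆U , A∩B , A∩C , B∩C , _) i =
  indicator-disjointParts (lookup A i) (lookup B i) (lookup C i) _
    (λ a → []=⇒lookup (A⊆U i (lookup⇒[]= i A a)))
    (λ b → []=⇒lookup (B⊆U i (lookup⇒[]= i B b)))
    (λ c → []=⇒lookup (C⊆U i (lookup⇒[]= i C c)))
    (λ a b → A∩B i (lookup⇒[]= i A a) (lookup⇒[]= i B b))
    (λ a c → A∩C i (lookup⇒[]= i A a) (lookup⇒[]= i C c))
    (λ b c → B∩C i (lookup⇒[]= i B b) (lookup⇒[]= i C c))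

module _ (f : ℕ → ℕ) (𝒮 : SepAlg) (valid : IsSeparationAlgorithm f 𝒮) where

  stateOccurrences-sttStep : ∀ {n} (G : Graph n) (s : State n) i →
    stateOccurrences i (sttStep f 𝒮 G s) ≤ stateOccurrences i s
  stateOccurrences-sttStep G ⟨ [] , sc ⟩ i = ≤-refl
  stateOccurrences-sttStep {n} G ⟨ (U , w) ∷ sb , sc ⟩ i
    with does (∣ U ∣ ≤? f n) | 𝒮 G U | valid G U
  ... | true  | _ | _ =
    ≤-trans (+-monoʳ-≤ (occurrences i sb) (occurrences-popUntil i (dropLast w) sc))
            (+-monoˡ-≤ (occurrences i sc) (m≤n+m _ _))
  ... | false | (A , B , C) | separation = begin
    a + (b + x) + (c + y)     ≡⟨ regroup ⟩
    (a + (b + c)) + (x + y)   ≤⟨ +-mono-≤ (validSeparation-indicator f G separation i)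
                                          (+-monoʳ-≤ x (occurrences-popUntil i (dropLast w) sc)) ⟩
    u + (x + z)               ≡⟨ sym (+-assoc u x z) ⟩
    u + x + z                 ∎
    where
    open ≤-Reasoning
    a = indicator (lookup A i)
    b = indicator (lookup B i)
    c = indicator (lookup C i)
    u = indicator (lookup U i)
    x = occurrences i sb
    y = occurrences i (popUntil (dropLast w) sc)
    z = occurrences i sc
    regroup : a + (b + x) + (c + y) ≡ (a + (b + c)) + (x + y)
    regroup = solve 5
      (λ a b c x y → a :+ (b :+ x) :+ (c :+ y) := (a :+ (b :+ c)) :+ (x :+ y))
      refl a b c x y
      where open +-*-Solver

  stateOccurrences-sttRun≤1 : ∀ {n} (G : Graph n) k i → stateOccurrences i (sttRun f 𝒮 G k) ≤ 1
  stateOccurrences-sttRun≤1 G zero    i rewrite lookup-replicate i true = ≤-refl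
  stateOccurrences-sttRun≤1 G (suc k) i =
    ≤-trans (stateOccurrences-sttStep G (sttRun f 𝒮 G k) i) (stateOccurrences-sttRun≤1 G k i)

  memory-sttRun≤ : ∀ {n} (G : Graph n) k → memory (sttRun f 𝒮 G k) ≤ n
  memory-sttRun≤ {n} G k = begin
    memory s                              ≡⟨ sym (stackSize-++ (stackB s) (stackC s)) ⟩
    stackSize (stackB s ++ stackC s)      ≤⟨ stackSize≤n*m (stackB s ++ stackC s) atMostOnce ⟩
    n * 1                                 ≡⟨ *-identityʳ n ⟩
    n                                     ∎
    where
    open ≤-Reasoning
    s = sttRun f 𝒮 G k
    atMostOnce : ∀ i → occurrences i (stackB s ++ stackC s) ≤ 1
    atMostOnce i = subst (_≤ 1) (sym (occurrences-++ i (stackB s) (stackC s)))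
                         (stateOccurrences-sttRun≤1 G k i)

proposition4 : (f : ℕ → ℕ) (𝒮 : SepAlg) → IsSeparationAlgorithm f 𝒮 →
    ∃ λ c → ∀ (n : ℕ) (G : Graph n) → Connected G →
      ∀ (k : ℕ) → memory (sttRun f 𝒮 G k) ≤ c * n
proposition4 f 𝒮 valid = 1 , λ n G _ k →
  subst (memory (sttRun f 𝒮 G k) ≤_) (sym (*-identityˡ n)) (memory-sttRun≤ f 𝒮 valid G k)
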